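{- Let $G\in\mathscr{G}_{a,b}$ be a graph containing a cycle and having at least one pendant vertex, and let $P_{k+1}=v_0v_1\ldots v_k$ be a longest pendant path in $G$. Then $k=1$.
   Context: All graphs are finite, simple, connected, with at least one edge; $d_G(v)$ is the degree of $v$ and $N_G(v)$ its neighbourhood. A pendant vertex is a vertex of degree $1$. For integers $a,b$, $\mathscr{G}_{a,b}$ denotes the set of such graphs $G$ for which $(a,b)$ is the unique pair of integers such that $\sum_{u\in N_G(v)}d_G(u)=a\,d_G(v)+b-d_G(v)^2$ for every $v\in V_G$. The base $\widetilde G$ of $G$ is the subgraph obtained by repeatedly deleting pendant vertices until none remain. If $G$ contains a cycle and has pendant vertices, a pendant path is a path $v_0v_1\ldots v_k$ with $v_0$ a pendant vertex of $G$, $v_1,\dots,v_{k-1}\notin V_{\widetilde G}$ and $v_k\in V_{\widetilde G}$; a longest pendant path is one of maximum length $k$. -}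

module Defs where

open import Data.Nat using (ℕ; zero; suc; _<_; _≡ᵇ_)
open import Data.Nat.Properties using ()
open import Data.Bool using (Bool; true; false; if_then_else_; _∧_; not)
open import Data.Fin using (Fin; zero; suc; toℕ; inject₁; fromℕ)
open import Data.List using (List; tabulate)
open import Data.Nat.ListAction using (sum)
open import Data.Integer as ℤ using (ℤ; +_)
open import Data.Product using (Σ; ∃; _×_; _,_)
open import Data.Sum using (_⊎_)
open import Relation.Binary.PropositionalEquality using (_≡_)
open import Relation.Nullary using (¬_)
open import Function.Definitions using (Injective)

record Graph (n : ℕ) : Set where
  field
    adj    : Fin n → Fin n → Bool
    adj-sym : ∀ u v → adj u v ≡ adj v u
    adj-irr : ∀ v → adj v v ≡ false
open Graph public

module _ {n : ℕ} (G : Graph n) where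

  Edge : Fin n → Fin n → Set
  Edge u v = adj G u v ≡ true

  deg : Fin n → ℕ
  deg v = sum (tabulate {n = n} (λ u → if adj G v u then 1 else 0))

  nbrDegSum : Fin n → ℕ
  nbrDegSum v = sum (tabulate {n = n} (λ u → if adj G v u then deg u else 0))

  Pendant : Fin n → Set
  Pendant v = deg v ≡ 1

  data Reachable (u : Fin n) : Fin n → Set where
    here : Reachable u u
    step : ∀ {v w} → Reachable u v → Edge v w → Reachable u w

  Connected : Set
  Connected = ∀ u v → Reachable u v

  HasEdge : Set
  HasEdge = Σ (Fin n) λ u → Σ (Fin n) λ v → Edge u v

  HasCycle : Set
  HasCycle = Σ ℕ λ m → Σ (Fin (suc (suc (suc m))) → Fin n) λ c →
    Injective _≡_ _≡_ c
    × (∀ (i : Fin (suc (suc m))) → Edge (c (inject₁ i)) (c (suc i)))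
    × Edge (c (fromℕ (suc (suc m)))) (c zero)

  HasPendant : Set
  HasPendant = Σ (Fin n) Pendant

  Identity : ℤ → ℤ → Set
  Identity a b = ∀ v →
    + nbrDegSum v ≡ (a ℤ.* + deg v ℤ.+ b) ℤ.- (+ deg v ℤ.* + deg v)

  -- G ∈ 𝒢_{a,b}: (a,b) is the unique pair of integers satisfying the identity
  InClass : ℤ → ℤ → Set
  InClass a b = Identity a b × (∀ a' b' → Identity a' b' → (a' ≡ a × b' ≡ b))

  degIn : (Fin n → Bool) → Fin n → ℕ
  degIn S v = sum (tabulate {n = n} (λ u → if S u ∧ adj G v u then 1 else 0))

  pruneStep : (Fin n → Bool) → (Fin n → Bool)
  pruneStep S v = S v ∧ not (degIn S v ≡ᵇ 1)

  iter : ℕ → (Fin n → Bool) → (Fin n → Bool)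
  iter zero    S = S
  iter (suc k) S = pruneStep (iter k S)

  -- vertex set of the base G̃ (n rounds suffice to reach the fixed point)
  baseSet : Fin n → Bool
  baseSet = iter n (λ _ → true)

  InBase : Fin n → Set
  InBase v = baseSet v ≡ true

  PendantPath : (k : ℕ) → (Fin (suc k) → Fin n) → Set
  PendantPath k p =
    Injective _≡_ _≡_ p
    × (∀ (i : Fin k) → Edge (p (inject₁ i)) (p (suc i)))
    × Pendant (p zero)
    × (∀ (i : Fin (suc k)) → 0 < toℕ i → toℕ i < k → ¬ InBase (p i))
    × InBase (p (fromℕ k))

  LongestPendantPath : (k : ℕ) → (Fin (suc k) → Fin n) → Set
  LongestPendantPath k p =
    PendantPath k p × (∀ k' (q : Fin (suc k') → Fin n) → PendantPath k' q → k' Data.Nat.≤ k)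

module Submission where

open import Defs
open import Data.Nat
  using (ℕ; zero; suc; _+_; _*_; _∸_; _≤_; _<_; _≤′_; ≤′-reflexive; ≤′-step; z≤n; s≤s; z<s; s<s; _≡ᵇ_; _≟_)
open import Data.Nat.Properties
  using ( ≤-trans; ≤-reflexive; m≤m+n; m≤n+m; +-monoʳ-≤; +-comm; +-identityʳ; +-suc
        ; +-cancelˡ-≤; +-cancelˡ-<; n≢0⇒n>0; ≤⇒≤′; +-commutativeSemigroup)
open import Data.Nat.ListAction using (sum)
open import Data.Nat.Tactic.RingSolver as ℕ-Solver using ()
open import Data.Integer as ℤ using (ℤ; +_; -[1+_])
open import Data.Integer.Properties as ℤP using ()
open import Data.Integer.Tactic.RingSolver as ℤ-Solver using ()
open import Data.Fin using (Fin; zero; suc; fromℕ)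
open import Data.Fin.Properties using (suc-injective; toℕ<n) renaming (_≟_ to _≟ᶠ_)
open import Data.Bool using (Bool; true; false; if_then_else_; _∧_; not)
open import Data.Bool.Properties using (∧-zeroʳ; ∧-identityʳ)
open import Data.List using (tabulate)
open import Data.List.Properties using (tabulate-cong)
open import Data.Product using (∃; _×_; _,_; proj₁; proj₂)
open import Data.Sum using (_⊎_; inj₁; inj₂)
open import Data.Empty using (⊥; ⊥-elim)
open import Function using (_∘_)
open import Relation.Binary.PropositionalEquality
open import Relation.Nullary using (¬_; yes; no; contradiction)
open import Algebra.Properties.CommutativeSemigroup +-commutativeSemigroup using (interchange)

-- Write f(d) = a d + b − d² for the right-hand side of the defining identity.  If a
-- pendant path had length k ≥ 2, its vertex v₁ would have degree ≥ 2 yet not lie in the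
-- base; since pruning stops at the first round that removes nothing, its second round
-- removes some vertex s: s is not pendant and has exactly one non-pendant neighbour t.
-- Reading the identity at a pendant neighbour of s, at s and at t gives f(1) = d(s),
-- f(d(s)) = d(s) + 1 + (d(t) − 2) and, because f is a parabola through these points,
-- Σ_{u∼t} d(u) ≤ f(d(s)); this forces s to be the only non-pendant neighbour of t too.
-- Then by connectivity every vertex other than s and t is a leaf, contradicting the
-- existence of a cycle.  A path of length 0 is impossible because a pendant vertex is
-- removed in the first round.

private
  variable
    n : ℕ

∑ : (Fin n → ℕ) → ℕ
∑ g = sum (tabulate g)

∑-cong : {g h : Fin n → ℕ} → (∀ u → g u ≡ h u) → ∑ g ≡ ∑ h
∑-cong g≗h = cong sum (tabulate-cong g≗h)

∑-distrib-+ : (g h : Fin n → ℕ) → ∑ (λ u → g u + h u) ≡ ∑ g + ∑ h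
∑-distrib-+ {zero}  g h = refl
∑-distrib-+ {suc n} g h =
  trans (cong (_+_ (g zero + h zero)) (∑-distrib-+ (g ∘ suc) (h ∘ suc)))
        (interchange (g zero) (h zero) (∑ (g ∘ suc)) (∑ (h ∘ suc)))

∑-zero : (g : Fin n → ℕ) → (∀ u → g u ≡ 0) → ∑ g ≡ 0
∑-zero {zero}  g _   = refl
∑-zero {suc n} g g≡0 = cong₂ _+_ (g≡0 zero) (∑-zero (g ∘ suc) (g≡0 ∘ suc))

∑-concentrated : (g : Fin n → ℕ) (t : Fin n) → (∀ u → u ≢ t → g u ≡ 0) → ∑ g ≡ g t
∑-concentrated g zero vanish =
  trans (cong (_+_ (g zero)) (∑-zero (g ∘ suc) (λ u → vanish (suc u) λ ()))) (+-identityʳ _)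
∑-concentrated g (suc t) vanish =
  cong₂ _+_ (vanish zero λ ())
            (∑-concentrated (g ∘ suc) t (λ u u≢t → vanish (suc u) (u≢t ∘ suc-injective)))

term≤∑ : (g : Fin n → ℕ) (x : Fin n) → g x ≤ ∑ g
term≤∑ g zero    = m≤m+n (g zero) _
term≤∑ g (suc x) = ≤-trans (term≤∑ (g ∘ suc) x) (m≤n+m _ (g zero))

two-terms≤∑ : (g : Fin n → ℕ) {x y : Fin n} → x ≢ y → g x + g y ≤ ∑ g
two-terms≤∑ g {zero}  {zero}  x≢y = contradiction refl x≢y
two-terms≤∑ g {zero}  {suc y} _   = +-monoʳ-≤ (g zero) (term≤∑ (g ∘ suc) y)
two-terms≤∑ g {suc x} {zero}  _   =
  subst (_≤ ∑ g) (+-comm (g zero) (g (suc x))) (+-monoʳ-≤ (g zero) (term≤∑ (g ∘ suc) x))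
two-terms≤∑ g {suc x} {suc y} x≢y =
  ≤-trans (two-terms≤∑ (g ∘ suc) (x≢y ∘ cong suc)) (m≤n+m _ (g zero))

∑-positive : (g : Fin n → ℕ) → 0 < ∑ g → ∃ λ u → 0 < g u
∑-positive {suc n} g pos with g zero ≟ 0
... | no  g₀≢0 = zero , n≢0⇒n>0 g₀≢0
... | yes g₀≡0 with ∑-positive (g ∘ suc) (subst (λ m → 0 < m + ∑ (g ∘ suc)) g₀≡0 pos)
...   | u , pos-u = suc u , pos-u

count : (Fin n → Bool) → ℕ
count P = ∑ λ u → if P u then 1 else 0

count-split : (Q P : Fin n → Bool) →
  count P ≡ count (λ u → Q u ∧ P u) + count (λ u → not (Q u) ∧ P u)
count-split Q P =
  trans (∑-cong split)
        (∑-distrib-+ (λ u → if Q u ∧ P u then 1 else 0) (λ u → if not (Q u) ∧ P u then 1 else 0))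
  where
  split : ∀ u → (if P u then 1 else 0)
              ≡ (if Q u ∧ P u then 1 else 0) + (if not (Q u) ∧ P u then 1 else 0)
  split u with Q u | P u
  ... | true  | true  = refl
  ... | true  | false = refl
  ... | false | true  = refl
  ... | false | false = refl

count-≥1 : {P : Fin n → Bool} {x : Fin n} → P x ≡ true → 1 ≤ count P
count-≥1 {P = P} {x} Px = subst (λ b → (if b then 1 else 0) ≤ count P) Px (term≤∑ _ x)

count≤1-unique : {P : Fin n → Bool} {x y : Fin n} →
  count P ≤ 1 → P x ≡ true → P y ≡ true → x ≡ y
count≤1-unique {P = P} {x} {y} count≤1 Px Py with x ≟ᶠ y
... | yes x≡y = x≡y
... | no  x≢y = contradiction (≤-trans two≤count count≤1) λ { (s≤s ()) }
  where
  two≤count : 2 ≤ count P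
  two≤count = subst₂ (λ b c → (if b then 1 else 0) + (if c then 1 else 0) ≤ count P) Px Py
                     (two-terms≤∑ _ x≢y)

count-positive : (P : Fin n → Bool) → 0 < count P → ∃ λ u → P u ≡ true
count-positive P pos with ∑-positive _ pos
... | u , pos-u = u , indicator-positive (P u) pos-u
  where
  indicator-positive : ∀ b → 0 < (if b then 1 else 0) → b ≡ true
  indicator-positive true _ = refl

∧-true : ∀ {b c} → b ∧ c ≡ true → b ≡ true × c ≡ true
∧-true {true} {true} _ = refl , refl

∧-absorbs : ∀ b c → (b ≡ true → b ∧ c ≡ true) → b ∧ c ≡ b
∧-absorbs true  _ keeps = keeps refl
∧-absorbs false _ _     = refl

not-not≡ᵇ1⇒≡1 : ∀ {m} → not (not (m ≡ᵇ 1)) ≡ true → m ≡ 1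
not-not≡ᵇ1⇒≡1 {1} _ = refl

not≡ᵇ1⇒≢1 : ∀ {m} → not (m ≡ᵇ 1) ≡ true → m ≢ 1
not≡ᵇ1⇒≢1 () refl

≢1⇒not≡ᵇ1 : ∀ {m} → m ≢ 1 → not (m ≡ᵇ 1) ≡ true
≢1⇒not≡ᵇ1 {zero}        _   = refl
≢1⇒not≡ᵇ1 {suc zero}    m≢1 = contradiction refl m≢1
≢1⇒not≡ᵇ1 {suc (suc m)} _   = refl

≢1⇒≡2+ : ∀ {m} → 1 ≤ m → m ≢ 1 → ∃ λ y → m ≡ 2 + y
≢1⇒≡2+ {suc zero}    _ m≢1 = contradiction refl m≢1
≢1⇒≡2+ {suc (suc y)} _ _   = y , refl

≡1+[≢1]+∸2 : ∀ {d} → 1 ≤ d → d ≡ 1 + ((if not (d ≡ᵇ 1) then 1 else 0) + (d ∸ 2))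
≡1+[≢1]+∸2 {suc zero}    _ = refl
≡1+[≢1]+∸2 {suc (suc d)} _ = refl

≤3+y+e⇒≤1 : ∀ {e y N H} → 2 + e + (N + H) ≤ 3 + y + e → y ≤ H → N ≤ 1
≤3+y+e⇒≤1 {e} {y} {N} {H} bound y≤H =
  +-cancelˡ-≤ (2 + y + e) N 1
    (subst₂ _≤_ (rearrange e N y) (rearrange-bound y e)
      (≤-trans (+-monoʳ-≤ (2 + e) (+-monoʳ-≤ N y≤H)) bound))
  where
  rearrange : ∀ e N y → 2 + e + (N + y) ≡ 2 + y + e + N
  rearrange = ℕ-Solver.solve-∀
  rearrange-bound : ∀ y e → 3 + y + e ≡ 2 + y + e + 1
  rearrange-bound = ℕ-Solver.solve-∀

no-three-distinct-in-pair : {A : Set} {s t x y z : A} → x ≢ y → x ≢ z → y ≢ z →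
  x ≡ s ⊎ x ≡ t → y ≡ s ⊎ y ≡ t → z ≡ s ⊎ z ≡ t → ⊥
no-three-distinct-in-pair x≢y _   _   (inj₁ refl) (inj₁ refl) _           = x≢y refl
no-three-distinct-in-pair x≢y _   _   (inj₂ refl) (inj₂ refl) _           = x≢y refl
no-three-distinct-in-pair _   x≢z _   (inj₁ refl) (inj₂ refl) (inj₁ refl) = x≢z refl
no-three-distinct-in-pair _   _   y≢z (inj₁ refl) (inj₂ refl) (inj₂ refl) = y≢z refl
no-three-distinct-in-pair _   _   y≢z (inj₂ refl) (inj₁ refl) (inj₁ refl) = y≢z refl
no-three-distinct-in-pair _   x≢z _   (inj₂ refl) (inj₁ refl) (inj₂ refl) = x≢z refl

quadratic : ℤ → ℤ → ℤ → ℤ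
quadratic a b x = (a ℤ.* x ℤ.+ b) ℤ.- (x ℤ.* x)

positive-factor : ∀ {y e} m → + suc y ℤ.* m ≡ + suc e → ∃ λ k → m ≡ + suc k
positive-factor {y} (+ zero) eq = contradiction (trans (sym (ℤP.*-zeroʳ (+ suc y))) eq) λ ()
positive-factor (+ suc k) _ = k , refl
positive-factor -[1+ _ ] ()

-- f(2+y) − f(1) = (1+y)(a−3−y) = 1+e forces a = 4+y+k with 1+e = (1+y)(1+k), and then
-- f(2+y) − f(2+e) = y k (1+y)(1+k) ≥ 0.
quadratic-bound : ∀ (a b : ℤ) {y e F : ℕ} →
  + (2 + y) ≡ quadratic a b (+ 1) →
  + (3 + y + e) ≡ quadratic a b (+ (2 + y)) →
  + F ≡ quadratic a b (+ (2 + e)) →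
  F ≤ 3 + y + e
quadratic-bound a b {y} {e} {F} at-1 at-2+y at-2+e =
  subst (F ≤_) (ℤP.+-injective F+gap≡) (m≤m+n F (y * k * suc y * suc k))
  where
  open ≡-Reasoning

  secant : ∀ a b Y → let q x = (a ℤ.* x ℤ.+ b) ℤ.- x ℤ.* x in
    q (+ 2 ℤ.+ Y) ℤ.- q (+ 1) ≡ (+ 1 ℤ.+ Y) ℤ.* (a ℤ.- (+ 3 ℤ.+ Y))
  secant = ℤ-Solver.solve-∀

  difference : ∀ Y E → (+ 3 ℤ.+ Y ℤ.+ E) ℤ.- (+ 2 ℤ.+ Y) ≡ + 1 ℤ.+ E
  difference = ℤ-Solver.solve-∀

  slope≡ : + suc y ℤ.* (a ℤ.- + (3 + y)) ≡ + suc e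
  slope≡ = begin
    + suc y ℤ.* (a ℤ.- + (3 + y))                      ≡⟨ secant a b (+ y) ⟨
    quadratic a b (+ (2 + y)) ℤ.- quadratic a b (+ 1)  ≡⟨ cong₂ ℤ._-_ at-2+y at-1 ⟨
    + (3 + y + e) ℤ.- + (2 + y)                        ≡⟨ difference (+ y) (+ e) ⟩
    + suc e                                            ∎

  k : ℕ
  k = proj₁ (positive-factor {y} {e} _ slope≡)

  slope : a ℤ.- + (3 + y) ≡ + suc k
  slope = proj₂ (positive-factor {y} {e} _ slope≡)

  a≡ : a ≡ + (3 + y) ℤ.+ + suc k
  a≡ = trans (split-off a (+ (3 + y))) (cong (ℤ._+_ (+ (3 + y))) slope)
    where
    split-off : ∀ a c → a ≡ c ℤ.+ (a ℤ.- c)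
    split-off = ℤ-Solver.solve-∀

  suc-e≡ : + suc e ≡ + suc y ℤ.* + suc k
  suc-e≡ = trans (sym slope≡) (cong (+ suc y ℤ.*_) slope)

  gap-identity : ∀ {a b Y K S} →
    a ≡ (+ 3 ℤ.+ Y) ℤ.+ (+ 1 ℤ.+ K) → S ≡ (+ 1 ℤ.+ Y) ℤ.* (+ 1 ℤ.+ K) →
    let q x = (a ℤ.* x ℤ.+ b) ℤ.- x ℤ.* x in
    q (+ 1 ℤ.+ S) ℤ.+ Y ℤ.* K ℤ.* (+ 1 ℤ.+ Y) ℤ.* (+ 1 ℤ.+ K) ≡ q (+ 2 ℤ.+ Y)
  gap-identity {b = b} {Y} {K} refl refl = ℤ-Solver.solve (b ∷ Y ∷ K ∷ [])
    where open import Data.List using (_∷_; [])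

  gap≡ : + (y * k * suc y * suc k) ≡ + y ℤ.* + k ℤ.* + suc y ℤ.* + suc k
  gap≡ = trans (ℤP.pos-* (y * k * suc y) (suc k))
           (cong (ℤ._* + suc k) (trans (ℤP.pos-* (y * k) (suc y))
                                        (cong (ℤ._* + suc y) (ℤP.pos-* y k))))

  F+gap≡ : + (F + y * k * suc y * suc k) ≡ + (3 + y + e)
  F+gap≡ = begin
    + F ℤ.+ + (y * k * suc y * suc k)
      ≡⟨ cong₂ ℤ._+_ at-2+e gap≡ ⟩
    quadratic a b (+ (2 + e)) ℤ.+ + y ℤ.* + k ℤ.* + suc y ℤ.* + suc k
      ≡⟨ gap-identity {Y = + y} {K = + k} a≡ suc-e≡ ⟩
    quadratic a b (+ (2 + y))
      ≡⟨ at-2+y ⟨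
    + (3 + y + e)
      ∎

module _ {n : ℕ} (G : Graph n) where

  Edge-sym : ∀ {u v} → Edge G u v → Edge G v u
  Edge-sym {u} {v} e = trans (adj-sym G v u) e

  neighbour⇒deg≥1 : ∀ {u v} → Edge G u v → 1 ≤ deg G v
  neighbour⇒deg≥1 {v = v} e = count-≥1 {P = adj G v} (Edge-sym e)

  pendant-neighbour-unique : ∀ {v x y} → Pendant G v → Edge G v x → Edge G v y → x ≡ y
  pendant-neighbour-unique {v} deg≡1 = count≤1-unique {P = adj G v} (≤-reflexive deg≡1)

  two-neighbours⇒¬Pendant : ∀ {v x y} → Edge G v x → Edge G v y → x ≢ y → ¬ Pendant G v
  two-neighbours⇒¬Pendant ex ey x≢y pendant = x≢y (pendant-neighbour-unique pendant ex ey)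

  pendant-nbrDegSum : ∀ {v s} → Pendant G v → Edge G v s → nbrDegSum G v ≡ deg G s
  pendant-nbrDegSum {v} {s} pendant e =
    trans (∑-concentrated _ s vanish) (cong (λ b → if b then deg G s else 0) e)
    where
    vanish : ∀ u → u ≢ s → (if adj G v u then deg G u else 0) ≡ 0
    vanish u u≢s with adj G v u in e′
    ... | false = refl
    ... | true  = contradiction (pendant-neighbour-unique pendant e′ e) u≢s

  identity-at : ∀ a b → Identity G a b → ∀ v {X d} → nbrDegSum G v ≡ X → deg G v ≡ d →
    + X ≡ quadratic a b (+ d)
  identity-at a b identity v refl refl = identity v

  -- iter G 1 (λ _ → true) reduces to nonPendant, and degIn G nonPendant to nonPendantDeg.
  nonPendant : Fin n → Bool
  nonPendant u = not (deg G u ≡ᵇ 1)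

  nonPendantDeg : Fin n → ℕ
  nonPendantDeg v = count (λ u → nonPendant u ∧ adj G v u)

  excess : Fin n → ℕ
  excess v = ∑ λ u → if adj G v u then deg G u ∸ 2 else 0

  -- Each neighbour u contributes d(u) = 1 + [u is not pendant] + (d(u) ∸ 2).
  nbrDegSum-split : ∀ v → nbrDegSum G v ≡ deg G v + (nonPendantDeg v + excess v)
  nbrDegSum-split v = begin
    nbrDegSum G v
      ≡⟨ ∑-cong termwise ⟩
    ∑ (λ u → [adj] u + ([nonPendant∧adj] u + [excess] u))
      ≡⟨ ∑-distrib-+ [adj] _ ⟩
    deg G v + ∑ (λ u → [nonPendant∧adj] u + [excess] u)
      ≡⟨ cong (_+_ (deg G v)) (∑-distrib-+ [nonPendant∧adj] [excess]) ⟩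
    deg G v + (nonPendantDeg v + excess v)
      ∎
    where
    open ≡-Reasoning
    [adj] [nonPendant∧adj] [excess] : Fin n → ℕ
    [adj] u = if adj G v u then 1 else 0
    [nonPendant∧adj] u = if nonPendant u ∧ adj G v u then 1 else 0
    [excess] u = if adj G v u then deg G u ∸ 2 else 0
    termwise : ∀ u → (if adj G v u then deg G u else 0) ≡ [adj] u + ([nonPendant∧adj] u + [excess] u)
    termwise u with adj G v u in e
    ... | false rewrite ∧-zeroʳ (nonPendant u) = refl
    ... | true  rewrite ∧-identityʳ (nonPendant u) = ≡1+[≢1]+∸2 (neighbour⇒deg≥1 e)

  nonPendantDeg≤1-unique : ∀ {v x y} → nonPendantDeg v ≤ 1 →
    Edge G v x → ¬ Pendant G x → Edge G v y → ¬ Pendant G y → x ≡ y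
  nonPendantDeg≤1-unique bound ex ¬px ey ¬py =
    count≤1-unique bound (cong₂ _∧_ (≢1⇒not≡ᵇ1 ¬px) ex) (cong₂ _∧_ (≢1⇒not≡ᵇ1 ¬py) ey)

  pendant-neighbour-exists : ∀ {v} → nonPendantDeg v < deg G v → ∃ λ u → Edge G v u × Pendant G u
  pendant-neighbour-exists {v} npd<deg with count-positive (λ u → not (nonPendant u) ∧ adj G v u) positive
    where
    positive : 0 < count (λ u → not (nonPendant u) ∧ adj G v u)
    positive = +-cancelˡ-< (nonPendantDeg v) 0 _
      (subst₂ _<_ (sym (+-identityʳ _)) (count-split nonPendant (adj G v)) npd<deg)
  ... | u , pendant∧adj with ∧-true pendant∧adj
  ...   | pendant , e = u , e , not-not≡ᵇ1⇒≡1 pendant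

  excess-of-unique-nonPendant : ∀ {v t} → Edge G v t →
    (∀ {u} → Edge G v u → ¬ Pendant G u → u ≡ t) → excess v ≡ deg G t ∸ 2
  excess-of-unique-nonPendant {v} {t} e-vt only-t =
    trans (∑-concentrated _ t vanish) (cong (λ b → if b then deg G t ∸ 2 else 0) e-vt)
    where
    vanish : ∀ u → u ≢ t → (if adj G v u then deg G u ∸ 2 else 0) ≡ 0
    vanish u u≢t with adj G v u in e
    ... | false = refl
    ... | true with deg G u ≟ 1
    ...   | yes pendant  = cong (_∸ 2) pendant
    ...   | no  ¬pendant = contradiction (only-t e ¬pendant) u≢t

  neighbour-excess : ∀ {v u} → Edge G v u → deg G u ∸ 2 ≤ excess v
  neighbour-excess {v} {u} e =
    subst (λ b → (if b then deg G u ∸ 2 else 0) ≤ excess v) e (term≤∑ _ u)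

  nonPendant-within-pair : Connected G → ∀ {s t} →
    (∀ {u} → Edge G s u → ¬ Pendant G u → u ≡ t) →
    (∀ {u} → Edge G t u → ¬ Pendant G u → u ≡ s) →
    ∀ x → ¬ Pendant G x → x ≡ s ⊎ x ≡ t
  nonPendant-within-pair connected {s} {t} only-t only-s x ¬pendant-x with near (connected s x)
    where
    Near : Fin n → Set
    Near x = x ≡ s ⊎ x ≡ t ⊎ (Pendant G x × (Edge G x s ⊎ Edge G x t))

    Near-step : ∀ {v w} → Near v → Edge G v w → Near w
    Near-step {w = w} (inj₁ refl) e with deg G w ≟ 1
    ... | yes pendant  = inj₂ (inj₂ (pendant , inj₁ (Edge-sym e)))
    ... | no  ¬pendant = inj₂ (inj₁ (only-t e ¬pendant))
    Near-step {w = w} (inj₂ (inj₁ refl)) e with deg G w ≟ 1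
    ... | yes pendant  = inj₂ (inj₂ (pendant , inj₂ (Edge-sym e)))
    ... | no  ¬pendant = inj₁ (only-s e ¬pendant)
    Near-step (inj₂ (inj₂ (pendant , inj₁ e-s))) e =
      inj₁ (pendant-neighbour-unique pendant e e-s)
    Near-step (inj₂ (inj₂ (pendant , inj₂ e-t))) e =
      inj₂ (inj₁ (pendant-neighbour-unique pendant e e-t))

    near : ∀ {x} → Reachable G s x → Near x
    near here         = inj₁ refl
    near (step r e) = Near-step (near r) e
  ... | inj₁ x≡s                  = inj₁ x≡s
  ... | inj₂ (inj₁ x≡t)           = inj₂ x≡t
  ... | inj₂ (inj₂ (pendant , _)) = contradiction pendant ¬pendant-x

  cycle⇒¬nonPendant⊆pair : HasCycle G → ∀ {s t} → ¬ (∀ x → ¬ Pendant G x → x ≡ s ⊎ x ≡ t)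
  cycle⇒¬nonPendant⊆pair (m , c , c-inj , c-edges , c-closed) within =
    no-three-distinct-in-pair (distinct λ ()) (distinct λ ()) (distinct λ ())
      (within c₀ (two-neighbours⇒¬Pendant (c-edges zero) (Edge-sym c-closed)
                                          (distinct λ ())))
      (within c₁ (two-neighbours⇒¬Pendant (Edge-sym (c-edges zero)) (c-edges (suc zero))
                                          (distinct λ ())))
      (within cₗ (two-neighbours⇒¬Pendant c-closed (Edge-sym (c-edges (fromℕ (suc m))))
                                          (distinct λ ())))
    where
    c₀ c₁ cₗ : Fin n
    c₀ = c zero
    c₁ = c (suc zero)
    cₗ = c (fromℕ (suc (suc m)))
    distinct : ∀ {i j} → i ≢ j → c i ≢ c j
    distinct i≢j = i≢j ∘ c-inj

  nonPendantDeg≢1 : ∀ a b → Identity G a b → Connected G → HasCycle G →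
    ∀ {s} → nonPendant s ≡ true → nonPendantDeg s ≢ 1
  nonPendantDeg≢1 a b identity connected cycle {s} np-s npd-s≡1
    with count-positive (λ u → nonPendant u ∧ adj G s u) (subst (0 <_) (sym npd-s≡1) z<s)
  ... | t , np-t∧e-st with ∧-true np-t∧e-st
  ... | np-t , e-st
    with ≢1⇒≡2+ (neighbour⇒deg≥1 (Edge-sym e-st)) (not≡ᵇ1⇒≢1 np-s)
       | ≢1⇒≡2+ (neighbour⇒deg≥1 e-st) (not≡ᵇ1⇒≢1 np-t)
  ... | y , deg-s | e , deg-t
    with pendant-neighbour-exists (subst₂ _<_ (sym npd-s≡1) (sym deg-s) (s<s z<s))
  ... | v₀ , e-sv₀ , pendant-v₀ =
    cycle⇒¬nonPendant⊆pair cycle (nonPendant-within-pair connected only-t only-s)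
    where
    only-t : ∀ {u} → Edge G s u → ¬ Pendant G u → u ≡ t
    only-t e ¬pendant =
      nonPendantDeg≤1-unique (≤-reflexive npd-s≡1) e ¬pendant e-st (not≡ᵇ1⇒≢1 np-t)

    f-v₀ : nbrDegSum G v₀ ≡ 2 + y
    f-v₀ = trans (pendant-nbrDegSum pendant-v₀ (Edge-sym e-sv₀)) deg-s

    excess-s : excess s ≡ e
    excess-s = trans (excess-of-unique-nonPendant e-st only-t) (cong (_∸ 2) deg-t)

    f-s : nbrDegSum G s ≡ 3 + y + e
    f-s = begin
      nbrDegSum G s                           ≡⟨ nbrDegSum-split s ⟩
      deg G s + (nonPendantDeg s + excess s)  ≡⟨ cong₂ _+_ deg-s (cong₂ _+_ npd-s≡1 excess-s) ⟩
      2 + y + (1 + e)                         ≡⟨ cong (_+_ 2) (+-suc y e) ⟩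
      3 + y + e                               ∎
      where open ≡-Reasoning

    f-t≤ : nbrDegSum G t ≤ 3 + y + e
    f-t≤ = quadratic-bound a b (identity-at a b identity v₀ f-v₀ pendant-v₀)
                               (identity-at a b identity s f-s deg-s)
                               (identity-at a b identity t refl deg-t)

    split-t≤ : 2 + e + (nonPendantDeg t + excess t) ≤ 3 + y + e
    split-t≤ = subst (_≤ 3 + y + e)
                     (trans (nbrDegSum-split t) (cong (_+ (nonPendantDeg t + excess t)) deg-t)) f-t≤

    excess-t≥y : y ≤ excess t
    excess-t≥y = subst (_≤ excess t) (cong (_∸ 2) deg-s) (neighbour-excess (Edge-sym e-st))

    only-s : ∀ {u} → Edge G t u → ¬ Pendant G u → u ≡ s
    only-s e ¬pendant =
      nonPendantDeg≤1-unique (≤3+y+e⇒≤1 split-t≤ excess-t≥y)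
                             e ¬pendant (Edge-sym e-st) (not≡ᵇ1⇒≢1 np-s)

  pruneStep-cong : ∀ {S T} → (∀ v → S v ≡ T v) → ∀ v → pruneStep G S v ≡ pruneStep G T v
  pruneStep-cong S≗T v =
    cong₂ (λ b d → b ∧ not (d ≡ᵇ 1)) (S≗T v)
          (∑-cong λ u → cong (λ b → if b ∧ adj G v u then 1 else 0) (S≗T u))

  pruneStep-⊆ : ∀ {S} v → pruneStep G S v ≡ true → S v ≡ true
  pruneStep-⊆ v kept = proj₁ (∧-true kept)

  pruneStep-fixed : ∀ {S} → (∀ v → S v ≡ true → pruneStep G S v ≡ true) →
    ∀ v → pruneStep G S v ≡ S v
  pruneStep-fixed {S} keeps v = ∧-absorbs (S v) _ (keeps v)

  iter-antitone : ∀ {S i j v} → i ≤′ j → iter G j S v ≡ true → iter G i S v ≡ true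
  iter-antitone (≤′-reflexive refl) kept = kept
  iter-antitone (≤′-step i≤′j)      kept = iter-antitone i≤′j (pruneStep-⊆ _ kept)

  iter-stable : ∀ {S i j} → (∀ v → iter G i S v ≡ true → iter G (suc i) S v ≡ true) →
    i ≤′ j → ∀ v → iter G j S v ≡ iter G i S v
  iter-stable keeps (≤′-reflexive refl) v = refl
  iter-stable keeps (≤′-step i≤′j)      v =
    trans (pruneStep-cong (iter-stable keeps i≤′j) v) (pruneStep-fixed keeps v)

  1≤′n : Fin n → 1 ≤′ n
  1≤′n v = ≤⇒≤′ (≤-trans (s≤s z≤n) (toℕ<n v))

  pendant⇒¬InBase : ∀ {v} → Pendant G v → ¬ InBase G v
  pendant⇒¬InBase {v} pendant in-base = not≡ᵇ1⇒≢1 (iter-antitone (1≤′n v) in-base) pendant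

  nonPendant⇒InBase : ∀ a b → Identity G a b → Connected G → HasCycle G →
    ∀ v → nonPendant v ≡ true → InBase G v
  nonPendant⇒InBase a b identity connected cycle v np-v =
    trans (iter-stable survives-round₂ (1≤′n v) v) np-v
    where
    survives-round₂ : ∀ u → nonPendant u ≡ true → iter G 2 (λ _ → true) u ≡ true
    survives-round₂ u np-u =
      trans (cong (λ b → b ∧ not (nonPendantDeg u ≡ᵇ 1)) np-u)
            (≢1⇒not≡ᵇ1 (nonPendantDeg≢1 a b identity connected cycle np-u))

lemma1p7 : ∀ {n : ℕ} (G : Graph n) (a b : ℤ) →
    InClass G a b → Connected G → HasEdge G →
    HasCycle G → HasPendant G →
    ∀ (k : ℕ) (p : Fin (suc k) → Fin n) → LongestPendantPath G k p →
    k ≡ 1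
lemma1p7 G a b _ _ _ _ _ zero p ((_ , _ , p₀-pendant , _ , p₀-in-base) , _) =
  ⊥-elim (pendant⇒¬InBase G p₀-pendant p₀-in-base)
lemma1p7 G a b _ _ _ _ _ (suc zero) p _ = refl
lemma1p7 G a b (identity , _) connected _ cycle _ (suc (suc k)) p
         ((p-inj , p-edges , _ , p-interior , _) , _) =
  ⊥-elim (p-interior (suc zero) (s≤s z≤n) (s≤s (s≤s z≤n))
            (nonPendant⇒InBase G a b identity connected cycle (p (suc zero)) v₁-nonPendant))
  where
  v₁-nonPendant : nonPendant G (p (suc zero)) ≡ true
  v₁-nonPendant = ≢1⇒not≡ᵇ1 (two-neighbours⇒¬Pendant G (Edge-sym G (p-edges zero)) (p-edges (suc zero))
                                                      ((λ ()) ∘ p-inj))
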